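{- Let $m,l,\delta\in\mathbb{N}$ and let $T$ be a tree with $T\in\mathcal{T}_{m,l+1}^{\delta}$. Let $n\ge m$ and let $H=H_1\vee H_2$, where $H_1$ is a graph on $l$ vertices and $H_2$ is a graph on $n-l$ vertices. (i) If $\Delta(H_2)\ge\delta$, then $T$ can be embedded in $H$. (ii) If $\Delta(H_2)\le\delta-1$ and at most one vertex of $H_2$ has degree $\delta-1$, then $T$ cannot be embedded in $H$.
   Context: Every tree $T$ has a unique bipartition $\{A,B\}$ with $|A|\le|B|$. $\mathcal{T}_{m,l+1}^{\delta}$ denotes the set of trees on $m$ vertices whose smaller partite set $A$ has exactly $l+1$ vertices and such that $\min\{d_T(v):v\in A\}=\delta$ (when $|A|=|B|$ this minimum equals $1$ for either choice of $A$). For vertex-disjoint graphs $G_1,G_2$, the join $G_1\vee G_2$ is the graph on $V(G_1)\cup V(G_2)$ with edge set $E(G_1)\cup E(G_2)\cup\{uv:u\in V(G_1),v\in V(G_2)\}$. "$T$ can be embedded in $H$" means $H$ contains a subgraph isomorphic to $T$. $\Delta(\cdot)$ denotes maximum degree. -}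

module Defs where

open import Data.Nat using (ℕ; zero; suc; _+_; _∸_; _≤_)
open import Data.Bool using (Bool; true; false; if_then_else_)
open import Data.Fin using (Fin; splitAt)
open import Data.Sum using (_⊎_; inj₁; inj₂)
open import Data.Product using (Σ; ∃; _×_; _,_)
open import Data.List using (List; []; _∷_; length; map; allFin; _∷ʳ_)
open import Data.Nat.ListAction using (sum)
open import Data.List.Relation.Unary.Linked using (Linked)
open import Data.List.Relation.Unary.Unique.Propositional using (Unique)
open import Relation.Binary.PropositionalEquality using (_≡_; refl)
open import Relation.Nullary using (¬_)
open import Function.Definitions using (Injective)

record Graph (n : ℕ) : Set where
  field
    adj    : Fin n → Fin n → Bool
    sym    : ∀ i j → adj i j ≡ adj j i
    irrefl : ∀ i → adj i i ≡ false
open Graph public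

Adj : ∀ {n} → Graph n → Fin n → Fin n → Set
Adj G i j = adj G i j ≡ true

count : ∀ {n} → (Fin n → Bool) → ℕ
count {n} p = sum (map (λ j → if p j then 1 else 0) (allFin n))

deg : ∀ {n} → Graph n → Fin n → ℕ
deg G i = count (adj G i)

data Walk {n} (G : Graph n) : Fin n → Fin n → Set where
  here : ∀ {i} → Walk G i i
  step : ∀ {i j k} → Adj G i j → Walk G j k → Walk G i k

Connected : ∀ {n} → Graph n → Set
Connected G = ∀ i j → Walk G i j

HasCycle : ∀ {n} → Graph n → Set
HasCycle {n} G = Σ (Fin n) λ u → Σ (List (Fin n)) λ vs →
  Unique (u ∷ vs) × (2 ≤ length vs) × Linked (Adj G) (u ∷ vs ∷ʳ u)

IsTree : ∀ {n} → Graph n → Set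
IsTree G = Connected G × ¬ HasCycle G

-- proper 2-colouring = bipartition {A = c⁻¹(true), B = c⁻¹(false)}
ProperColouring : ∀ {n} → Graph n → (Fin n → Bool) → Set
ProperColouring G c = ∀ i j → Adj G i j → ¬ (c i ≡ c j)

inA : ∀ {n} → (Fin n → Bool) → Fin n → Set
inA c v = c v ≡ true

not : Bool → Bool
not true = false
not false = true

-- T ∈ 𝒯^δ_{m,l+1}: the (unique) bipartition {A,B} of T with |A| ≤ |B| has |A| = l+1
-- and min{ d_T(v) : v ∈ A } = δ.
InClass : ∀ {m} → Graph m → ℕ → ℕ → Set
InClass {m} T l δ = Σ (Fin m → Bool) λ c →
  ProperColouring T c ×
  count c ≡ suc l ×
  count c ≤ count (λ v → not (c v)) ×
  (Σ (Fin m) λ v → inA c v × deg T v ≡ δ) ×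
  (∀ v → inA c v → δ ≤ deg T v)

joinAdj' : ∀ {a b} → Graph a → Graph b → Fin a ⊎ Fin b → Fin a ⊎ Fin b → Bool
joinAdj' G₁ G₂ (inj₁ x) (inj₁ y) = adj G₁ x y
joinAdj' G₁ G₂ (inj₂ x) (inj₂ y) = adj G₂ x y
joinAdj' G₁ G₂ (inj₁ x) (inj₂ y) = true
joinAdj' G₁ G₂ (inj₂ x) (inj₁ y) = true

joinAdj'-sym : ∀ {a b} (G₁ : Graph a) (G₂ : Graph b) x y → joinAdj' G₁ G₂ x y ≡ joinAdj' G₁ G₂ y x
joinAdj'-sym G₁ G₂ (inj₁ x) (inj₁ y) = sym G₁ x y
joinAdj'-sym G₁ G₂ (inj₂ x) (inj₂ y) = sym G₂ x y
joinAdj'-sym G₁ G₂ (inj₁ x) (inj₂ y) = refl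
joinAdj'-sym G₁ G₂ (inj₂ x) (inj₁ y) = refl

joinAdj'-irrefl : ∀ {a b} (G₁ : Graph a) (G₂ : Graph b) x → joinAdj' G₁ G₂ x x ≡ false
joinAdj'-irrefl G₁ G₂ (inj₁ x) = irrefl G₁ x
joinAdj'-irrefl G₁ G₂ (inj₂ x) = irrefl G₂ x

_∨G_ : ∀ {a b} → Graph a → Graph b → Graph (a + b)
_∨G_ {a} G₁ G₂ = record
  { adj = λ i j → joinAdj' G₁ G₂ (splitAt a i) (splitAt a j)
  ; sym = λ i j → joinAdj'-sym G₁ G₂ (splitAt a i) (splitAt a j)
  ; irrefl = λ i → joinAdj'-irrefl G₁ G₂ (splitAt a i)
  }

EmbedsIn : ∀ {m n} → Graph m → Graph n → Set
EmbedsIn {m} {n} T H = Σ (Fin m → Fin n) λ f →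
  Injective _≡_ _≡_ f × (∀ i j → Adj T i j → Adj H (f i) (f j))

MaxDegGe : ∀ {n} → Graph n → ℕ → Set
MaxDegGe {n} G d = Σ (Fin n) λ v → d ≤ deg G v

MaxDegLe : ∀ {n} → Graph n → ℕ → Set
MaxDegLe G d = ∀ v → deg G v ≤ d

-- (i) Let v ∈ A have degree δ and w ∈ H₂ degree at least δ. Send v to w, the other l vertices of A
-- onto H₁, N(v) into N(w) and the rest of B into the remaining vertices of H₂; as every vertex of H₁
-- is joined to every vertex of H₂, each edge of T lands on an edge of H.
-- (ii) Given an embedding f, let X be the set of vertices sent into H₁, so |X| ≤ l. Root T at the
-- vertex of A sent to the vertex of degree δ − 1 of H₂, if there is one. Each a ∈ A ∖ X has at least
-- δ neighbours, at most deg_H₂(f a) ≤ δ − 1 of them outside X; so it has a neighbour in X, and two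
-- unless it is the root, hence a child in X ∩ B. A child determines its parent, so |A ∖ X| ≤ |X ∩ B|
-- and l + 1 = |A| ≤ |X| ≤ l.

module Submission where

open import Defs hiding (sym)
open import Data.Bool using (Bool; true; false; _∧_; if_then_else_)
open import Data.Bool.Properties
  using (¬-not; ∧-comm; ∧-zeroʳ; ∧-identityʳ; ∧-conicalˡ; ∧-conicalʳ) renaming (_≟_ to _≟ᵇ_)
open import Data.Empty using (⊥; ⊥-elim)
open import Data.Fin using (Fin; zero; suc; splitAt; _↑ˡ_; _↑ʳ_)
open import Data.Fin.Properties
  using ( _≟_; any?; 0≢1+n; splitAt-↑ˡ; splitAt-↑ʳ; splitAt⁻¹-↑ˡ; splitAt⁻¹-↑ʳ
        ; ↑ˡ-injective; ↑ʳ-injective)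
import Data.Fin.Properties as Fin
open import Data.List
  using (List; []; _∷_; [_]; _++_; _∷ʳ_; _ʳ++_; reverse; length; map; allFin; filter; zip)
open import Data.List.Properties
  using ( map-tabulate; map-cong; map-++; length-++; length-map; length-tabulate; length-reverse
        ; length-++-sucʳ; ++-identityʳ; ++-assoc; reverse-++; ʳ++-defn)
open import Data.List.Membership.Propositional using (_∈_; _∉_)
open import Data.List.Membership.Propositional.Properties
  using (∈-filter⁺; ∈-filter⁻; ∈-allFin; ∈-map⁻; ∈-++⁻; ∈-++⁺ˡ; ∈-++⁺ʳ; ∈-∃++)
open import Data.List.Relation.Unary.All using (All; []; _∷_; lookup)
open import Data.List.Relation.Unary.All.Properties
  using (All¬⇒¬Any; ¬Any⇒All¬) renaming (++⁻ˡ to All-++⁻ˡ)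
open import Data.List.Relation.Unary.AllPairs using ([]; _∷_)
open import Data.List.Relation.Unary.Any using (here; there)
open import Data.List.Relation.Unary.Any.Properties using (reverse⁻)
open import Data.List.Relation.Unary.Linked using (Linked; []; [-]; _∷_)
import Data.List.Relation.Unary.Linked as Linked
open import Data.List.Relation.Unary.Unique.Propositional using (Unique)
import Data.List.Relation.Unary.Unique.Propositional.Properties as Unique
open import Data.Nat using (ℕ; zero; suc; _∸_; _≤_; _+_; z≤n; s≤s; s≤s⁻¹)
open import Data.Nat.ListAction using (sum)
open import Data.Nat.Properties
  using ( module ≤-Reasoning; ≤-trans; +-suc; n≤1+n; n<1+n; m≤n+m; m≤m+n; +-cancelʳ-≤; +-monoʳ-≤
        ; 1+n≰n; ≤∧≢⇒<; m+[n∸m]≡n; suc-injective) renaming (_≟_ to _≟ℕ_)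
import Data.Product as Product
open import Data.Product using (∃; ∃₂; _×_; _,_; proj₁; proj₂)
import Data.Sum as Sum
open import Data.Sum using (_⊎_; inj₁; inj₂; [_,_]′)
open import Function using (_∘_; id)
open import Function.Definitions using (Injective)
open import Relation.Binary.PropositionalEquality hiding ([_])
open import Relation.Nullary using (¬_; Dec; yes; no; does)
open import Relation.Nullary.Decidable using (dec-true; dec-false; _×-dec_)

-- Counting vertices

true≢false : ¬ true ≡ false
true≢false ()

not-true : ∀ {b} → not b ≡ true → b ≡ false
not-true {false} _ = refl

indicator : Bool → ℕ
indicator b = if b then 1 else 0

_≟?_ : ∀ {n} → Fin n → Fin n → Bool
x ≟? y = does (x ≟ y)

count-suc : ∀ {n} (p : Fin (suc n) → Bool) → count p ≡ indicator (p zero) + count (p ∘ suc)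
count-suc {n} p = cong (λ xs → indicator (p zero) + sum xs)
  (trans (map-tabulate suc (indicator ∘ p)) (sym (map-tabulate id (indicator ∘ p ∘ suc))))

count-cong : ∀ {n} {p q : Fin n → Bool} → (∀ x → p x ≡ q x) → count p ≡ count q
count-cong {n} p≗q = cong sum (map-cong (λ x → cong indicator (p≗q x)) (allFin n))

count-false : ∀ n → count {n} (λ _ → false) ≡ 0
count-false zero = refl
count-false (suc n) = trans (count-suc {n} (λ _ → false)) (count-false n)

count-true : ∀ n → count {n} (λ _ → true) ≡ n
count-true zero = refl
count-true (suc n) = trans (count-suc {n} (λ _ → true)) (cong suc (count-true n))

count-≟ : ∀ {n} (z : Fin n) → count (_≟? z) ≡ 1
count-≟ {suc n} zero = trans (count-suc {n} (_≟? zero)) (cong suc (count-false n))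
count-≟ {suc n} (suc z) = trans (count-suc (_≟? suc z)) (count-≟ z)

count-split : ∀ {n} (p q : Fin n → Bool) →
  count p ≡ count (λ x → p x ∧ q x) + count (λ x → p x ∧ not (q x))
count-split {zero} p q = refl
count-split {suc n} p q
  rewrite count-suc p | count-suc (λ x → p x ∧ q x) | count-suc (λ x → p x ∧ not (q x))
        | count-split (p ∘ suc) (q ∘ suc)
  with p zero | q zero
... | false | _ = refl
... | true | true = refl
... | true | false = sym (+-suc _ _)

count-complement : ∀ {n} (p : Fin n → Bool) → count p + count (not ∘ p) ≡ n
count-complement {n} p = trans (sym (count-split (λ _ → true) p)) (count-true n)

count-positive : ∀ {n} (p : Fin n → Bool) {x : Fin n} → p x ≡ true → 1 ≤ count p
count-positive p {zero} px rewrite count-suc p | px = s≤s z≤n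
count-positive p {suc x} px rewrite count-suc p =
  ≤-trans (count-positive (p ∘ suc) px) (m≤n+m _ (indicator (p zero)))

count-witness : ∀ {n} (p : Fin n → Bool) → 1 ≤ count p → ∃ λ x → p x ≡ true
count-witness {suc n} p 1≤count = witness (p zero) refl (subst (1 ≤_) (count-suc p) 1≤count)
  where
  witness : ∀ b → p zero ≡ b → 1 ≤ indicator b + count (p ∘ suc) → ∃ λ x → p x ≡ true
  witness true p0 _ = zero , p0
  witness false _ 1≤count′ with count-witness (p ∘ suc) 1≤count′
  ... | x , px = suc x , px

count-remove : ∀ {n} (p : Fin n → Bool) {z : Fin n} → p z ≡ true →
  count p ≡ suc (count (λ x → p x ∧ not (x ≟? z)))
count-remove p {z} pz = trans (count-split p (_≟? z))
  (cong (_+ count (λ x → p x ∧ not (x ≟? z))) (trans (count-cong p∧≟z≗≟z) (count-≟ z)))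
  where
  p∧≟z≗≟z : ∀ x → (p x ∧ (x ≟? z)) ≡ (x ≟? z)
  p∧≟z≗≟z x with x ≟ z
  ... | yes refl = trans (∧-identityʳ (p z)) pz
  ... | no _ = ∧-zeroʳ (p x)

count-two-witnesses : ∀ {n} (p : Fin n → Bool) → 2 ≤ count p →
  ∃₂ λ x y → p x ≡ true × p y ≡ true × ¬ x ≡ y
count-two-witnesses p 2≤count with count-witness p (≤-trans (s≤s z≤n) 2≤count)
... | x , px with count-witness (λ y → p y ∧ not (y ≟? x))
                   (s≤s⁻¹ (subst (2 ≤_) (count-remove p px) 2≤count))
...   | y , py∧y≢x = x , y , px , ∧-conicalˡ _ _ py∧y≢x , x≢y
  where
  x≢y : ¬ x ≡ y
  x≢y refl with () ← trans (sym (dec-true (x ≟ x) refl)) (not-true (∧-conicalʳ _ _ py∧y≢x))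

count-injection : ∀ {a b} (P : Fin a → Bool) (Q : Fin b → Bool)
  (g : ∀ x → P x ≡ true → Fin b) →
  (∀ x px → Q (g x px) ≡ true) →
  (∀ x y px py → g x px ≡ g y py → x ≡ y) →
  count P ≤ count Q
count-injection {zero} P Q g g∈Q g-inj = z≤n
count-injection {suc a} P Q g g∈Q g-inj =
  subst (_≤ count Q) (sym (count-suc P)) (by-cases (P zero) refl)
  where
  g-inj-suc : ∀ x y px py → g (suc x) px ≡ g (suc y) py → x ≡ y
  g-inj-suc x y px py eq = Fin.suc-injective (g-inj (suc x) (suc y) px py eq)
  by-cases : ∀ b → P zero ≡ b → indicator b + count (P ∘ suc) ≤ count Q
  by-cases false _ = count-injection (P ∘ suc) Q (g ∘ suc) (g∈Q ∘ suc) g-inj-suc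
  by-cases true p0 = subst (suc (count (P ∘ suc)) ≤_) (sym (count-remove Q (g∈Q zero p0)))
    (s≤s (count-injection (P ∘ suc) _ (g ∘ suc)
      (λ x px → cong₂ _∧_ (g∈Q (suc x) px)
        (cong not (dec-false (_ ≟ _) (λ eq → 0≢1+n (g-inj zero (suc x) p0 px (sym eq))))))
      g-inj-suc))

select : ∀ {n} → (Fin n → Bool) → List (Fin n)
select {n} p = filter (λ x → p x ≟ᵇ true) (allFin n)

length-select : ∀ {n} (p : Fin n → Bool) → length (select p) ≡ count p
length-select {n} p = go (allFin n)
  where
  go : ∀ xs → length (filter (λ x → p x ≟ᵇ true) xs) ≡ sum (map (indicator ∘ p) xs)
  go [] = refl
  go (x ∷ xs) with p x
  ... | true = cong suc (go xs)
  ... | false = go xs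

∈-select⁺ : ∀ {n} (p : Fin n → Bool) {x} → p x ≡ true → x ∈ select p
∈-select⁺ p {x} = ∈-filter⁺ (λ x → p x ≟ᵇ true) (∈-allFin x)

∈-select⁻ : ∀ {n} (p : Fin n → Bool) {x} → x ∈ select p → p x ≡ true
∈-select⁻ {n} p = proj₂ ∘ ∈-filter⁻ (λ x → p x ≟ᵇ true) {xs = allFin n}

select-unique : ∀ {n} (p : Fin n → Bool) → Unique (select p)
select-unique {n} p = Unique.filter⁺ (λ x → p x ≟ᵇ true) (Unique.allFin⁺ n)

module _ {A B : Set} where

  ∈-zip⁻ : ∀ {x : A} {y : B} xs ys → (x , y) ∈ zip xs ys → x ∈ xs × y ∈ ys
  ∈-zip⁻ (_ ∷ _) (_ ∷ _) (here refl) = here refl , here refl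
  ∈-zip⁻ (_ ∷ xs) (_ ∷ ys) (there p) = Product.map there there (∈-zip⁻ xs ys p)

  zip-total : ∀ {x : A} xs (ys : List B) → x ∈ xs → length xs ≤ length ys →
    ∃ λ y → (x , y) ∈ zip xs ys
  zip-total (_ ∷ _) (y ∷ _) (here refl) _ = y , here refl
  zip-total (_ ∷ xs) (_ ∷ ys) (there x∈xs) (s≤s len≤) =
    Product.map₂ there (zip-total xs ys x∈xs len≤)

  zip-injective : ∀ {x x′ : A} {y : B} xs ys → Unique ys →
    (x , y) ∈ zip xs ys → (x′ , y) ∈ zip xs ys → x ≡ x′
  zip-injective (_ ∷ _) (_ ∷ _) _ (here refl) (here refl) = refl
  zip-injective (_ ∷ xs) (_ ∷ ys) (y∉ys ∷ _) (here refl) (there p′) =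
    ⊥-elim (All¬⇒¬Any y∉ys (proj₂ (∈-zip⁻ xs ys p′)))
  zip-injective (_ ∷ xs) (_ ∷ ys) (y∉ys ∷ _) (there p) (here refl) =
    ⊥-elim (All¬⇒¬Any y∉ys (proj₂ (∈-zip⁻ xs ys p)))
  zip-injective (_ ∷ xs) (_ ∷ ys) (_ ∷ unique) (there p) (there p′) =
    zip-injective xs ys unique p p′

  ∈-zip-++⁻ : ∀ {x : A} {y : B} xs₁ xs₂ ys₁ ys₂ → length xs₁ ≡ length ys₁ →
    (x , y) ∈ zip (xs₁ ++ xs₂) (ys₁ ++ ys₂) → (x , y) ∈ zip xs₁ ys₁ ⊎ (x , y) ∈ zip xs₂ ys₂
  ∈-zip-++⁻ [] _ [] _ _ p = inj₂ p
  ∈-zip-++⁻ (_ ∷ _) _ (_ ∷ _) _ _ (here eq) = inj₁ (here eq)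
  ∈-zip-++⁻ (_ ∷ xs₁) xs₂ (_ ∷ ys₁) ys₂ len≡ (there p) =
    Sum.map₁ there (∈-zip-++⁻ xs₁ xs₂ ys₁ ys₂ (suc-injective len≡) p)

  ∈-zip-++≤⁻ : ∀ {x : A} {y : B} xs₁ xs₂ ys₁ ys₂ → length xs₁ ≤ length ys₁ →
    (x , y) ∈ zip (xs₁ ++ xs₂) (ys₁ ++ ys₂) → (x , y) ∈ zip xs₁ ys₁ ⊎ x ∈ xs₂
  ∈-zip-++≤⁻ [] xs₂ ys₁ ys₂ _ p = inj₂ (proj₁ (∈-zip⁻ xs₂ (ys₁ ++ ys₂) p))
  ∈-zip-++≤⁻ (_ ∷ _) _ (_ ∷ _) _ _ (here eq) = inj₁ (here eq)
  ∈-zip-++≤⁻ (_ ∷ xs₁) xs₂ (_ ∷ ys₁) ys₂ (s≤s len≤) (there p) =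
    Sum.map₁ there (∈-zip-++≤⁻ xs₁ xs₂ ys₁ ys₂ len≤ p)

module _ {A : Set} where

  Unique-++⁻ˡ : ∀ (xs : List A) {ys} → Unique (xs ++ ys) → Unique xs
  Unique-++⁻ˡ [] _ = []
  Unique-++⁻ˡ (_ ∷ xs) (x∉ ∷ unique) = All-++⁻ˡ xs x∉ ∷ Unique-++⁻ˡ xs unique

  Unique-++⁻ʳ : ∀ (xs : List A) {ys} → Unique (xs ++ ys) → Unique ys
  Unique-++⁻ʳ [] unique = unique
  Unique-++⁻ʳ (_ ∷ xs) (_ ∷ unique) = Unique-++⁻ʳ xs unique

  Unique-shift : ∀ {x : A} xs {ys} → Unique (x ∷ xs ++ ys) → Unique (xs ++ x ∷ ys)
  Unique-shift [] unique = unique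
  Unique-shift (y ∷ xs) ((x≢y ∷ x∉) ∷ (y∉ ∷ unique)) =
    All-insert xs y∉ (x≢y ∘ sym) ∷ Unique-shift xs (x∉ ∷ unique)
    where
    All-insert : ∀ {P : A → Set} {x} xs {ys} → All P (xs ++ ys) → P x → All P (xs ++ x ∷ ys)
    All-insert [] all px = px ∷ all
    All-insert (_ ∷ xs) (py ∷ all) px = py ∷ All-insert xs all px

  Unique-ʳ++ : ∀ (xs ys : List A) → Unique (xs ++ ys) → Unique (xs ʳ++ ys)
  Unique-ʳ++ [] ys unique = unique
  Unique-ʳ++ (x ∷ xs) ys unique = Unique-ʳ++ xs (x ∷ ys) (Unique-shift xs unique)

  Unique-reverse : ∀ (xs : List A) → Unique xs → Unique (reverse xs)
  Unique-reverse xs unique = Unique-ʳ++ xs [] (subst Unique (sym (++-identityʳ xs)) unique)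

  module _ {R : A → A → Set} where

    Linked-++⁻ˡ : ∀ (xs : List A) {ys} → Linked R (xs ++ ys) → Linked R xs
    Linked-++⁻ˡ [] _ = []
    Linked-++⁻ˡ (_ ∷ []) _ = [-]
    Linked-++⁻ˡ (_ ∷ y ∷ xs) (r ∷ linked) = r ∷ Linked-++⁻ˡ (y ∷ xs) linked

    Linked-++⁻ʳ : ∀ (xs : List A) {ys} → Linked R (xs ++ ys) → Linked R ys
    Linked-++⁻ʳ [] linked = linked
    Linked-++⁻ʳ (_ ∷ xs) linked = Linked-++⁻ʳ xs (Linked.tail linked)

    Linked-glue : ∀ (xs : List A) {q ys} →
      Linked R (xs ++ [ q ]) → Linked R (q ∷ ys) → Linked R (xs ++ q ∷ ys)
    Linked-glue [] _ linked = linked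
    Linked-glue (_ ∷ []) (r ∷ _) linked = r ∷ linked
    Linked-glue (_ ∷ y ∷ xs) (r ∷ linked′) linked = r ∷ Linked-glue (y ∷ xs) linked′ linked

    Linked-reverse : (∀ {x y} → R x y → R y x) → ∀ xs → Linked R xs → Linked R (reverse xs)
    Linked-reverse R-sym [] _ = []
    Linked-reverse R-sym (x ∷ xs) linked = Linked.map R-sym (flip x xs [] linked [-])
      where
      flip : ∀ x xs ys → Linked R (x ∷ xs) → Linked (λ u v → R v u) (x ∷ ys) →
        Linked (λ u v → R v u) ((x ∷ xs) ʳ++ ys)
      flip x [] ys _ linked′ = linked′
      flip x (y ∷ xs) ys (r ∷ linked) linked′ = flip y xs (x ∷ ys) linked (r ∷ linked′)

Adj-sym : ∀ {n} (G : Graph n) {x y} → Adj G x y → Adj G y x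
Adj-sym G {x} {y} xy = trans (Graph.sym G y x) xy

deg-positive : ∀ {n} (G : Graph n) → Connected G → ∀ {x y} → ¬ x ≡ y → 1 ≤ deg G x
deg-positive G connected {x} {y} x≢y with connected x y
... | here = ⊥-elim (x≢y refl)
... | step xz _ = count-positive (adj G x) xz

colour-flips : ∀ {n} (G : Graph n) {c} → ProperColouring G c →
  ∀ {x y} → Adj G x y → c x ≡ true → c y ≡ false
colour-flips G {c} proper {x} {y} xy cx with c y in cy
... | false = refl
... | true = ⊥-elim (proper x y xy (trans cx (sym cy)))

↑ˡ≢↑ʳ : ∀ {l k} (a : Fin l) (b : Fin k) → ¬ a ↑ˡ k ≡ l ↑ʳ b
↑ˡ≢↑ʳ {l} {k} a b eq
  with () ← trans (sym (splitAt-↑ˡ l a k)) (trans (cong (splitAt l) eq) (splitAt-↑ʳ l k b))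

isLeft : ∀ l {k} → Fin (l + k) → Bool
isLeft l i = [ (λ _ → true) , (λ _ → false) ]′ (splitAt l i)

isLeft⇒↑ˡ : ∀ l {k} (i : Fin (l + k)) → isLeft l i ≡ true → ∃ λ a → a ↑ˡ k ≡ i
isLeft⇒↑ˡ l i _ with splitAt l i in eq
... | inj₁ a = a , splitAt⁻¹-↑ˡ eq

¬isLeft⇒↑ʳ : ∀ l {k} (i : Fin (l + k)) → isLeft l i ≡ false → ∃ λ b → l ↑ʳ b ≡ i
¬isLeft⇒↑ʳ l i _ with splitAt l i in eq
... | inj₂ b = b , splitAt⁻¹-↑ʳ eq

module _ {l k : ℕ} (H₁ : Graph l) (H₂ : Graph k) where

  ∨G-adj-↑ˡ↑ʳ : ∀ a b → Adj (H₁ ∨G H₂) (a ↑ˡ k) (l ↑ʳ b)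
  ∨G-adj-↑ˡ↑ʳ a b rewrite splitAt-↑ˡ l a k | splitAt-↑ʳ l k b = refl

  ∨G-adj-↑ʳ↑ʳ : ∀ a b → adj (H₁ ∨G H₂) (l ↑ʳ a) (l ↑ʳ b) ≡ adj H₂ a b
  ∨G-adj-↑ʳ↑ʳ a b rewrite splitAt-↑ʳ l k a | splitAt-↑ʳ l k b = refl

InClass⇒l<m : ∀ {m} (T : Graph m) {l δ} → InClass T l δ → suc l ≤ m
InClass⇒l<m T (c , _ , ∣A∣≡1+l , _) = subst₂ _≤_ ∣A∣≡1+l (count-complement c) (m≤m+n (count c) _)

InClass⇒1≤δ : ∀ {m} (T : Graph m) {l δ} → Connected T → InClass T l δ → 1 ≤ δ
InClass⇒1≤δ T connected (c , _ , ∣A∣≡1+l , ∣A∣≤∣B∣ , (v , v∈A , deg-v≡δ) , _)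
  with count-witness (not ∘ c) (≤-trans (subst (1 ≤_) (sym ∣A∣≡1+l) (s≤s z≤n)) ∣A∣≤∣B∣)
... | u , u∈B = subst (1 ≤_) deg-v≡δ (deg-positive T connected v≢u)
  where
  v≢u : ¬ v ≡ u
  v≢u refl = true≢false (trans (sym v∈A) (not-true u∈B))

-- Embedding T when Δ(H₂) ≥ δ

module Embedding {m l k : ℕ} (T : Graph m) (H₁ : Graph l) (H₂ : Graph k)
  (c : Fin m → Bool) (proper : ProperColouring T c) (∣A∣≡1+l : count c ≡ suc l)
  (v : Fin m) (v∈A : c v ≡ true) (w : Fin k) (deg-v≤deg-w : deg T v ≤ deg H₂ w)
  (m≤l+k : m ≤ l + k) where

  open ≡-Reasoning

  isA∖v isB∖Nv : Fin m → Bool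
  isA∖v x = c x ∧ not (x ≟? v)
  isB∖Nv x = not (c x) ∧ not (adj T v x)

  isH₂∖N[w] : Fin k → Bool
  isH₂∖N[w] y = not (adj H₂ w y) ∧ not (y ≟? w)

  A∖v Nv B∖Nv : List (Fin m)
  A∖v = select isA∖v
  Nv = select (adj T v)
  B∖Nv = select isB∖Nv

  Nw H₂∖N[w] : List (Fin k)
  Nw = select (adj H₂ w)
  H₂∖N[w] = select isH₂∖N[w]

  -- The embedding zips these two lists; listing N(v) and N(w) first makes N(v) land in N(w).
  source : List (Fin m)
  source = v ∷ A∖v ++ (Nv ++ B∖Nv)

  H₁-part H₂-part target : List (Fin (l + k))
  H₁-part = map (_↑ˡ k) (allFin l)
  H₂-part = map (l ↑ʳ_) (Nw ++ H₂∖N[w])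
  target = (l ↑ʳ w) ∷ H₁-part ++ H₂-part

  length-A∖v : length A∖v ≡ l
  length-A∖v = suc-injective (begin
    suc (length A∖v) ≡⟨ cong suc (length-select isA∖v) ⟩
    suc (count isA∖v) ≡⟨ count-remove c v∈A ⟨
    count c           ≡⟨ ∣A∣≡1+l ⟩
    suc l             ∎)

  length-B : length Nv + length B∖Nv ≡ count (not ∘ c)
  length-B = begin
    length Nv + length B∖Nv
      ≡⟨ cong₂ _+_ (length-select (adj T v)) (length-select isB∖Nv) ⟩
    count (adj T v) + count isB∖Nv
      ≡⟨ cong (_+ count isB∖Nv) (count-cong Nv⊆B) ⟨
    count (λ x → not (c x) ∧ adj T v x) + count isB∖Nv
      ≡⟨ count-split (not ∘ c) (adj T v) ⟨
    count (not ∘ c) ∎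
    where
    Nv⊆B : ∀ x → (not (c x) ∧ adj T v x) ≡ adj T v x
    Nv⊆B x with adj T v x in vx
    ... | true rewrite colour-flips T proper vx v∈A = refl
    ... | false = ∧-zeroʳ (not (c x))

  length-source : length source ≡ m
  length-source = begin
    suc (length (A∖v ++ (Nv ++ B∖Nv)))        ≡⟨ cong suc (length-++ A∖v) ⟩
    suc (length A∖v + length (Nv ++ B∖Nv))     ≡⟨ cong suc (cong₂ _+_ length-A∖v (length-++ Nv)) ⟩
    suc (l + (length Nv + length B∖Nv))        ≡⟨ cong (λ b → suc (l + b)) length-B ⟩
    suc l + count (not ∘ c)                    ≡⟨ cong (_+ count (not ∘ c)) ∣A∣≡1+l ⟨
    count c + count (not ∘ c)                  ≡⟨ count-complement c ⟩
    m                                          ∎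

  length-H₂ : suc (length Nw + length H₂∖N[w]) ≡ k
  length-H₂ = begin
    suc (length Nw + length H₂∖N[w])
      ≡⟨ cong suc (cong₂ _+_ (length-select (adj H₂ w)) (length-select isH₂∖N[w])) ⟩
    suc (count (adj H₂ w) + count isH₂∖N[w])
      ≡⟨ +-suc _ _ ⟨
    count (adj H₂ w) + suc (count isH₂∖N[w])
      ≡⟨ cong (count (adj H₂ w) +_) (count-remove (not ∘ adj H₂ w) (cong not (irrefl H₂ w))) ⟨
    count (adj H₂ w) + count (not ∘ adj H₂ w)
      ≡⟨ count-complement (adj H₂ w) ⟩
    k ∎

  H₁-part-length : length H₁-part ≡ l
  H₁-part-length = trans (length-map _ (allFin l)) (length-tabulate {n = l} id)

  length-target : length target ≡ l + k
  length-target = begin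
    suc (length (H₁-part ++ H₂-part))
      ≡⟨ cong suc (length-++ H₁-part) ⟩
    suc (length H₁-part + length H₂-part)
      ≡⟨ cong suc (cong₂ _+_ H₁-part-length (trans (length-map _ (Nw ++ H₂∖N[w])) (length-++ Nw))) ⟩
    suc (l + (length Nw + length H₂∖N[w]))
      ≡⟨ +-suc l _ ⟨
    l + suc (length Nw + length H₂∖N[w])
      ≡⟨ cong (l +_) length-H₂ ⟩
    l + k ∎

  target-unique : Unique target
  target-unique = ¬Any⇒All¬ _ w∉rest
    ∷ Unique.++⁺ (Unique.map⁺ (↑ˡ-injective k _ _) (Unique.allFin⁺ l))
                 (Unique.map⁺ (↑ʳ-injective l _ _) H₂-part-unique)
                 (λ (i , j) → left≢right i j)
    where
    left≢right : ∀ {y} → y ∈ H₁-part → y ∈ H₂-part → ⊥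
    left≢right i j with ∈-map⁻ (_↑ˡ k) i | ∈-map⁻ (l ↑ʳ_) j
    ... | a , _ , refl | b , _ , eq = ↑ˡ≢↑ʳ a b eq
    H₂-part-unique : Unique (Nw ++ H₂∖N[w])
    H₂-part-unique = Unique.++⁺ (select-unique _) (select-unique _)
      (λ (i , j) → true≢false (trans (sym (∈-select⁻ (adj H₂ w) i))
                                  (not-true (∧-conicalˡ _ _ (∈-select⁻ isH₂∖N[w] j)))))
    w∉rest : (l ↑ʳ w) ∉ H₁-part ++ H₂-part
    w∉rest i with ∈-++⁻ H₁-part i
    ... | inj₁ j with ∈-map⁻ (_↑ˡ k) j
    ...   | a , _ , eq = ↑ˡ≢↑ʳ a w (sym eq)
    w∉rest i | inj₂ j with ∈-map⁻ (l ↑ʳ_) j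
    ...   | b , b∈ , eq with ↑ʳ-injective l w b eq | ∈-++⁻ Nw b∈
    ...     | refl | inj₁ w∈Nw = true≢false (trans (sym (∈-select⁻ (adj H₂ w) w∈Nw)) (irrefl H₂ w))
    ...     | refl | inj₂ w∈rest = true≢false (trans (sym (dec-true (w ≟ w) refl))
                                     (not-true (∧-conicalʳ _ _ (∈-select⁻ isH₂∖N[w] w∈rest))))

  ∈-source : ∀ x → x ∈ source
  ∈-source x with x ≟ v | c x in cx | adj T v x in vx
  ... | yes x≡v | _ | _ = here x≡v
  ... | no x≢v | true | _ =
    there (∈-++⁺ˡ (∈-select⁺ isA∖v (cong₂ _∧_ cx (cong not (dec-false (x ≟ v) x≢v)))))
  ... | no _ | false | true = there (∈-++⁺ʳ A∖v (∈-++⁺ˡ (∈-select⁺ (adj T v) vx)))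
  ... | no _ | false | false =
    there (∈-++⁺ʳ A∖v (∈-++⁺ʳ Nv (∈-select⁺ isB∖Nv (cong₂ _∧_ (cong not cx) (cong not vx)))))

  paired : ∀ x → ∃ λ y → (x , y) ∈ zip source target
  paired x = zip-total source target (∈-source x)
    (subst₂ _≤_ (sym length-source) (sym length-target) m≤l+k)

  f : Fin m → Fin (l + k)
  f x = proj₁ (paired x)

  f-injective : Injective _≡_ _≡_ f
  f-injective {x} {x′} fx≡fx′ = zip-injective source target target-unique (proj₂ (paired x))
    (subst (λ y → (x′ , y) ∈ zip source target) (sym fx≡fx′) (proj₂ (paired x′)))

  pairing-blocks : ∀ {x y} → (x , y) ∈ zip source target →
    (x ≡ v × y ≡ l ↑ʳ w) ⊎ ((x , y) ∈ zip A∖v H₁-part ⊎ (x , y) ∈ zip (Nv ++ B∖Nv) H₂-part)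
  pairing-blocks (here refl) = inj₁ (refl , refl)
  pairing-blocks (there p) = inj₂ (∈-zip-++⁻ A∖v _ _ _ (trans length-A∖v (sym H₁-part-length)) p)

  A∖v⊆A : ∀ {x} → x ∈ A∖v → c x ≡ true
  A∖v⊆A = ∧-conicalˡ _ _ ∘ ∈-select⁻ isA∖v

  B-part⊆B : ∀ {x} → x ∈ Nv ++ B∖Nv → c x ≡ false
  B-part⊆B x∈ with ∈-++⁻ Nv x∈
  ... | inj₁ x∈Nv = colour-flips T proper (∈-select⁻ (adj T v) x∈Nv) v∈A
  ... | inj₂ x∈B∖Nv = not-true (∧-conicalˡ _ _ (∈-select⁻ isB∖Nv x∈B∖Nv))

  image-A : ∀ {x} → c x ≡ true → (x ≡ v × f x ≡ l ↑ʳ w) ⊎ ∃ λ a → f x ≡ a ↑ˡ k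
  image-A {x} cx with pairing-blocks (proj₂ (paired x))
  ... | inj₁ x≡v×fx≡w = inj₁ x≡v×fx≡w
  ... | inj₂ (inj₁ p) with ∈-map⁻ (_↑ˡ k) (proj₂ (∈-zip⁻ A∖v _ p))
  ...   | a , _ , fx≡a = inj₂ (a , fx≡a)
  image-A {x} cx | inj₂ (inj₂ p) =
    ⊥-elim (true≢false (trans (sym cx) (B-part⊆B (proj₁ (∈-zip⁻ _ _ p)))))

  image-B : ∀ {x} → c x ≡ false → ∃ λ b → f x ≡ l ↑ʳ b
  image-B {x} cx with pairing-blocks (proj₂ (paired x))
  ... | inj₁ (refl , _) = ⊥-elim (true≢false (trans (sym v∈A) cx))
  ... | inj₂ (inj₁ p) = ⊥-elim (true≢false (trans (sym (A∖v⊆A (proj₁ (∈-zip⁻ A∖v _ p)))) cx))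
  ... | inj₂ (inj₂ p) with ∈-map⁻ (l ↑ʳ_) (proj₂ (∈-zip⁻ (Nv ++ B∖Nv) _ p))
  ...   | b , _ , fx≡b = b , fx≡b

  image-Nv : ∀ {x} → Adj T v x → ∃ λ b → Adj H₂ w b × f x ≡ l ↑ʳ b
  image-Nv {x} vx with pairing-blocks (proj₂ (paired x))
  ... | inj₁ (refl , _) = ⊥-elim (true≢false (trans (sym vx) (irrefl T v)))
  ... | inj₂ (inj₁ p) = ⊥-elim (true≢false (trans (sym (A∖v⊆A (proj₁ (∈-zip⁻ A∖v _ p))))
                                                 (colour-flips T proper vx v∈A)))
  ... | inj₂ (inj₂ p)
    with ∈-zip-++≤⁻ Nv B∖Nv (map (l ↑ʳ_) Nw) (map (l ↑ʳ_) H₂∖N[w]) length-Nv≤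
           (subst (λ ys → (x , f x) ∈ zip (Nv ++ B∖Nv) ys) (map-++ (l ↑ʳ_) Nw H₂∖N[w]) p)
    where
    length-Nv≤ : length Nv ≤ length (map (l ↑ʳ_) Nw)
    length-Nv≤ = subst₂ _≤_ (sym (length-select (adj T v)))
      (sym (trans (length-map _ Nw) (length-select (adj H₂ w)))) deg-v≤deg-w
  ...   | inj₂ x∈B∖Nv =
    ⊥-elim (true≢false (trans (sym vx) (not-true (∧-conicalʳ _ _ (∈-select⁻ isB∖Nv x∈B∖Nv)))))
  ...   | inj₁ q with ∈-map⁻ (l ↑ʳ_) (proj₂ (∈-zip⁻ Nv _ q))
  ...     | b , b∈Nw , fx≡b = b , ∈-select⁻ (adj H₂ w) b∈Nw , fx≡b

  f-edge-from-A : ∀ {i j} → c i ≡ true → Adj T i j → Adj (H₁ ∨G H₂) (f i) (f j)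
  f-edge-from-A {i} {j} ci ij with image-A ci
  ... | inj₁ (refl , fi≡w) with image-Nv ij
  ...   | b , wb , fj≡b rewrite fi≡w | fj≡b = trans (∨G-adj-↑ʳ↑ʳ H₁ H₂ w b) wb
  f-edge-from-A {i} {j} ci ij | inj₂ (a , fi≡a) with image-B (colour-flips T proper ij ci)
  ...   | b , fj≡b rewrite fi≡a | fj≡b = ∨G-adj-↑ˡ↑ʳ H₁ H₂ a b

  f-edge : ∀ i j → Adj T i j → Adj (H₁ ∨G H₂) (f i) (f j)
  f-edge i j ij with c i ≟ᵇ true | c j ≟ᵇ true
  ... | yes ci | _ = f-edge-from-A ci ij
  ... | no _ | yes cj = Adj-sym (H₁ ∨G H₂) (f-edge-from-A cj (Adj-sym T ij))
  ... | no ci | no cj = ⊥-elim (proper i j ij (trans (¬-not ci) (sym (¬-not cj))))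

  embedding : EmbedsIn T (H₁ ∨G H₂)
  embedding = f , f-injective , f-edge

-- Rooted trees

module Paths {m : ℕ} (T : Graph m) (r : Fin m) where

  open import Data.List.Membership.DecPropositional (_≟_ {m}) using (_∈?_)

  EndsAtRoot : List (Fin m) → Set
  EndsAtRoot [] = ⊥
  EndsAtRoot (x ∷ []) = x ≡ r
  EndsAtRoot (_ ∷ y ∷ xs) = EndsAtRoot (y ∷ xs)

  PathToRoot : Fin m → List (Fin m) → Set
  PathToRoot x P = Unique (x ∷ P) × Linked (Adj T) (x ∷ P) × EndsAtRoot (x ∷ P)

  EndsAtRoot-++⁻ʳ : ∀ xs {y ys} → EndsAtRoot (xs ++ y ∷ ys) → EndsAtRoot (y ∷ ys)
  EndsAtRoot-++⁻ʳ [] ends = ends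
  EndsAtRoot-++⁻ʳ (_ ∷ []) ends = ends
  EndsAtRoot-++⁻ʳ (_ ∷ x ∷ xs) ends = EndsAtRoot-++⁻ʳ (x ∷ xs) ends

  root-∈ : ∀ xs → EndsAtRoot xs → r ∈ xs
  root-∈ (_ ∷ []) refl = here refl
  root-∈ (_ ∷ y ∷ xs) ends = there (root-∈ (y ∷ xs) ends)

  loop-erase : ∀ {x} → Walk T x r → ∃ (PathToRoot x)
  loop-erase here = [] , ([] ∷ []) , [-] , refl
  loop-erase {x} (step {j = y} xy walk) with loop-erase walk
  ... | P , unique , linked , ends with x ∈? (y ∷ P)
  ... | no x∉ = y ∷ P , (¬Any⇒All¬ (y ∷ P) x∉ ∷ unique) , (xy ∷ linked) , ends
  ... | yes x∈ with ∈-∃++ x∈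
  ... | P₁ , P₂ , eq = P₂ , Unique-++⁻ʳ P₁ (subst Unique eq unique)
                         , Linked-++⁻ʳ P₁ (subst (Linked (Adj T)) eq linked)
                         , EndsAtRoot-++⁻ʳ P₁ (subst EndsAtRoot eq ends)

  chord-or-cycle : ∀ {y x P} → PathToRoot y P → Adj T y x → x ∈ P →
    (∃ λ P′ → P ≡ x ∷ P′) ⊎ HasCycle T
  chord-or-cycle {P = _ ∷ P′} _ _ (here refl) = inj₁ (P′ , refl)
  chord-or-cycle {y} {x} {p ∷ _} (unique , linked , _) yx (there x∈)
    with ∈-∃++ x∈
  ... | P₁ , P₂ , refl = inj₂ (y , p ∷ P₁ ++ [ x ] , cycle-unique , length≥2 , cycle-linked)
    where
    reassoc : y ∷ p ∷ P₁ ++ x ∷ P₂ ≡ (y ∷ p ∷ P₁ ++ [ x ]) ++ P₂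
    reassoc = cong (λ zs → y ∷ p ∷ zs) (sym (++-assoc P₁ [ x ] P₂))
    cycle-unique : Unique (y ∷ p ∷ P₁ ++ [ x ])
    cycle-unique = Unique-++⁻ˡ (y ∷ p ∷ P₁ ++ [ x ]) (subst Unique reassoc unique)
    length≥2 : 2 ≤ length (p ∷ P₁ ++ [ x ])
    length≥2 = s≤s (subst (1 ≤_) (sym (length-++-sucʳ P₁ x [])) (s≤s z≤n))
    cycle-linked : Linked (Adj T) (y ∷ p ∷ ((P₁ ++ [ x ]) ++ [ y ]))
    cycle-linked = subst (Linked (Adj T)) (cong (λ zs → y ∷ p ∷ zs) (sym (++-assoc P₁ [ x ] [ y ])))
      (Linked-glue (y ∷ p ∷ P₁)
        (Linked-++⁻ˡ (y ∷ p ∷ P₁ ++ [ x ]) (subst (Linked (Adj T)) reassoc linked))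
        (Adj-sym T yx ∷ [-]))

  first-common : ∀ (S : List (Fin m)) → r ∈ S → ∀ xs → EndsAtRoot xs →
    ∃ λ xs₁ → ∃ λ q → ∃ λ xs₂ → xs ≡ xs₁ ++ q ∷ xs₂ × q ∈ S × All (_∉ S) xs₁
  first-common S r∈S (x ∷ xs) ends with x ∈? S
  ... | yes x∈S = [] , x , xs , refl , x∈S , []
  first-common S r∈S (x ∷ []) refl | no x∉S = ⊥-elim (x∉S r∈S)
  first-common S r∈S (x ∷ y ∷ xs) ends | no x∉S with first-common S r∈S (y ∷ xs) ends
  ... | xs₁ , q , xs₂ , eq , q∈S , xs₁∉S =
    x ∷ xs₁ , q , xs₂ , cong (x ∷_) eq , q∈S , (x∉S ∷ xs₁∉S)

  cycle-of-two-paths : ∀ {x q} P₁ Q₁ → 1 ≤ length P₁ + length Q₁ →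
    Unique (x ∷ P₁ ++ q ∷ reverse Q₁) →
    Linked (Adj T) (x ∷ P₁ ++ [ q ]) → Linked (Adj T) (x ∷ Q₁ ++ [ q ]) → HasCycle T
  cycle-of-two-paths {x} {q} P₁ Q₁ nonempty unique path-to-q path-to-q′ =
    x , P₁ ++ q ∷ reverse Q₁ , unique , length≥2 , cycle-linked
    where
    length≥2 : 2 ≤ length (P₁ ++ q ∷ reverse Q₁)
    length≥2 = subst (2 ≤_) (sym (begin
      length (P₁ ++ q ∷ reverse Q₁)           ≡⟨ length-++ P₁ ⟩
      length P₁ + suc (length (reverse Q₁))   ≡⟨ cong (λ n → length P₁ + suc n) (length-reverse Q₁) ⟩
      length P₁ + suc (length Q₁)             ≡⟨ +-suc (length P₁) _ ⟩
      suc (length P₁ + length Q₁)             ∎)) (s≤s nonempty)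
      where open ≡-Reasoning
    path-from-q : Linked (Adj T) (q ∷ reverse Q₁ ++ [ x ])
    path-from-q = subst (Linked (Adj T))
      (trans (ʳ++-defn (Q₁ ++ [ q ])) (cong (_++ [ x ]) (reverse-++ Q₁ [ q ])))
      (Linked-reverse (Adj-sym T) (x ∷ Q₁ ++ [ q ]) path-to-q′)
    cycle-linked : Linked (Adj T) (x ∷ (P₁ ++ q ∷ reverse Q₁) ∷ʳ x)
    cycle-linked = subst (Linked (Adj T)) (cong (x ∷_) (sym (++-assoc P₁ (q ∷ reverse Q₁) [ x ])))
      (Linked-glue (x ∷ P₁) path-to-q path-from-q)

  -- Follow a's path up to the first vertex q it shares with a′'s path, then return along a′'s path.
  two-paths-cycle : ∀ {x a a′ P Q} → ¬ a ≡ a′ → Adj T x a → Adj T x a′ →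
    PathToRoot a P → PathToRoot a′ Q → x ∉ a ∷ P → x ∉ a′ ∷ Q → HasCycle T
  two-paths-cycle {x} {a} {a′} {P} {Q} a≢a′ xa xa′ (uniqueP , linkedP , endsP) (uniqueQ , linkedQ , endsQ)
    x∉P x∉Q with first-common (a ∷ P) (root-∈ (a ∷ P) endsP) (a′ ∷ Q) endsQ
  ... | Q₁ , q , Q₂ , eqQ , q∈P , Q₁∉P with ∈-∃++ q∈P
  ... | P₁ , P₂ , eqP = cycle-of-two-paths P₁ Q₁ (nonempty P₁ Q₁ eqP eqQ) cycle-unique
    (Linked-++⁻ˡ (x ∷ P₁ ++ [ q ]) (subst (Linked (Adj T)) (cong (x ∷_) eqP′) (xa ∷ linkedP)))
    (Linked-++⁻ˡ (x ∷ Q₁ ++ [ q ]) (subst (Linked (Adj T)) (cong (x ∷_) eqQ′) (xa′ ∷ linkedQ)))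
    where
    eqP′ : a ∷ P ≡ (P₁ ++ [ q ]) ++ P₂
    eqP′ = trans eqP (sym (++-assoc P₁ [ q ] P₂))
    eqQ′ : a′ ∷ Q ≡ (Q₁ ++ [ q ]) ++ Q₂
    eqQ′ = trans eqQ (sym (++-assoc Q₁ [ q ] Q₂))
    on-P : ∀ {y} → y ∈ P₁ ++ [ q ] → y ∈ a ∷ P
    on-P y∈ = subst (_ ∈_) (sym eqP′) (∈-++⁺ˡ y∈)
    on-Q : ∀ {y} → y ∈ Q₁ → y ∈ a′ ∷ Q
    on-Q y∈ = subst (_ ∈_) (sym eqQ) (∈-++⁺ˡ y∈)
    nonempty : ∀ P₁ Q₁ → a ∷ P ≡ P₁ ++ q ∷ P₂ → a′ ∷ Q ≡ Q₁ ++ q ∷ Q₂ →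
      1 ≤ length P₁ + length Q₁
    nonempty [] [] refl refl = ⊥-elim (a≢a′ refl)
    nonempty [] (_ ∷ _) _ _ = s≤s z≤n
    nonempty (_ ∷ _) _ _ _ = s≤s z≤n
    x∉cycle : x ∉ P₁ ++ q ∷ reverse Q₁
    x∉cycle x∈ with ∈-++⁻ P₁ x∈
    ... | inj₁ x∈P₁ = x∉P (on-P (∈-++⁺ˡ x∈P₁))
    ... | inj₂ (here refl) = x∉P q∈P
    ... | inj₂ (there x∈Q₁) = x∉Q (on-Q (reverse⁻ x∈Q₁))
    cycle-unique : Unique (x ∷ P₁ ++ q ∷ reverse Q₁)
    cycle-unique = ¬Any⇒All¬ _ x∉cycle ∷ subst Unique (++-assoc P₁ [ q ] (reverse Q₁))
      (Unique.++⁺ (Unique-++⁻ˡ (P₁ ++ [ q ]) (subst Unique eqP′ uniqueP))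
                  (Unique-reverse Q₁ (Unique-++⁻ˡ Q₁ (subst Unique eqQ uniqueQ)))
                  (λ (y∈P , y∈Q₁) → lookup Q₁∉P (reverse⁻ y∈Q₁) (on-P y∈P)))

  module Rooted (connected : Connected T) (acyclic : ¬ HasCycle T) where

    path : ∀ x → ∃ (PathToRoot x)
    path x = loop-erase (connected x r)

    first-step : Fin m → List (Fin m) → Fin m
    first-step x [] = x
    first-step _ (y ∷ _) = y

    parent : Fin m → Fin m
    parent x = first-step x (proj₁ (path x))

    root-on-path : ∀ y → r ∈ y ∷ proj₁ (path y)
    root-on-path y = root-∈ (y ∷ proj₁ (path y)) (proj₂ (proj₂ (proj₂ (path y))))

    parent-of-neighbour : ∀ {x y} → Adj T x y → x ∉ y ∷ proj₁ (path y) → parent x ≡ y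
    parent-of-neighbour {x} {y} xy x∉ with y ∈? proj₁ (path x)
    ... | yes y∈ with chord-or-cycle (proj₂ (path x)) xy y∈
    ...   | inj₁ (_ , eq) = cong (first-step x) eq
    ...   | inj₂ cycle = ⊥-elim (acyclic cycle)
    parent-of-neighbour {x} {y} xy x∉ | no y∉ with path x
    ... | [] , _ , _ , refl = ⊥-elim (x∉ (root-on-path y))
    ... | x′ ∷ P , (x∉P ∷ unique) , (xx′ ∷ linked) , ends =
      ⊥-elim (acyclic (two-paths-cycle (λ y≡x′ → y∉ (here y≡x′)) xy xx′ (proj₂ (path y))
        (unique , linked , ends) x∉ (All¬⇒¬Any x∉P)))

    edge-parent : ∀ {x y} → Adj T x y → (¬ x ≡ r × parent x ≡ y) ⊎ parent y ≡ x
    edge-parent {x} {y} xy with x ∈? proj₁ (path y)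
    ... | yes x∈ with chord-or-cycle (proj₂ (path y)) (Adj-sym T xy) x∈
    ...   | inj₁ (_ , eq) = inj₂ (cong (first-step y) eq)
    ...   | inj₂ cycle = ⊥-elim (acyclic cycle)
    edge-parent {x} {y} xy | no x∉ = inj₁ (x≢r , parent-of-neighbour xy x∉y∷P)
      where
      x∉y∷P : x ∉ y ∷ proj₁ (path y)
      x∉y∷P (here refl) = true≢false (trans (sym xy) (irrefl T x))
      x∉y∷P (there x∈) = x∉ x∈
      x≢r : ¬ x ≡ r
      x≢r refl = x∉y∷P (root-on-path y)

-- No embedding when Δ(H₂) ≤ δ − 1

module NoEmbedding {m l k d : ℕ} (T : Graph m) (H₁ : Graph l) (H₂ : Graph k)
  (c : Fin m → Bool) (proper : ProperColouring T c) (∣A∣≡1+l : count c ≡ suc l)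
  (deg-A>d : ∀ a → c a ≡ true → suc d ≤ deg T a)
  (connected : Connected T) (acyclic : ¬ HasCycle T)
  (Δ≤d : ∀ z → deg H₂ z ≤ d) (deg-d-unique : ∀ u v → deg H₂ u ≡ d → deg H₂ v ≡ d → u ≡ v)
  (f : Fin m → Fin (l + k)) (f-injective : Injective _≡_ _≡_ f)
  (f-edge : ∀ i j → Adj T i j → Adj (H₁ ∨G H₂) (f i) (f j)) where

  X A′ A∩X X∩A X∩B : Fin m → Bool
  X x = isLeft l (f x)
  A′ x = c x ∧ not (X x)
  A∩X x = c x ∧ X x
  X∩A x = X x ∧ c x
  X∩B x = X x ∧ not (c x)

  ∣X∣≤l : count X ≤ l
  ∣X∣≤l = subst (count X ≤_) (count-true l)
    (count-injection X (λ _ → true) (λ x Xx → proj₁ (isLeft⇒↑ˡ l (f x) Xx)) (λ _ _ → refl)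
      (λ x y Xx Xy a≡b → f-injective (begin
        f x                                  ≡⟨ proj₂ (isLeft⇒↑ˡ l (f x) Xx) ⟨
        proj₁ (isLeft⇒↑ˡ l (f x) Xx) ↑ˡ k    ≡⟨ cong (_↑ˡ k) a≡b ⟩
        proj₁ (isLeft⇒↑ˡ l (f y) Xy) ↑ˡ k    ≡⟨ proj₂ (isLeft⇒↑ˡ l (f y) Xy) ⟩
        f y                                  ∎)))
    where open ≡-Reasoning

  image : ∀ a → not (X a) ≡ true → Fin k
  image a ¬Xa = proj₁ (¬isLeft⇒↑ʳ l (f a) (not-true ¬Xa))

  image-spec : ∀ a ¬Xa → l ↑ʳ image a ¬Xa ≡ f a
  image-spec a ¬Xa = proj₂ (¬isLeft⇒↑ʳ l (f a) (not-true ¬Xa))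

  image-injective : ∀ a b ¬Xa ¬Xb → image a ¬Xa ≡ image b ¬Xb → a ≡ b
  image-injective a b ¬Xa ¬Xb eq =
    f-injective (trans (sym (image-spec a ¬Xa)) (trans (cong (l ↑ʳ_) eq) (image-spec b ¬Xb)))

  outside-neighbours≤deg : ∀ a ¬Xa → count (λ x → adj T a x ∧ not (X x)) ≤ deg H₂ (image a ¬Xa)
  outside-neighbours≤deg a ¬Xa = count-injection _ (adj H₂ (image a ¬Xa))
    (λ x ax∧¬Xx → image x (∧-conicalʳ _ _ ax∧¬Xx))
    (λ x ax∧¬Xx → trans (sym (∨G-adj-↑ʳ↑ʳ H₁ H₂ _ _))
      (subst₂ (Adj (H₁ ∨G H₂)) (sym (image-spec a ¬Xa)) (sym (image-spec x _))
        (f-edge a x (∧-conicalˡ _ _ ax∧¬Xx))))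
    (λ x y _ _ → image-injective x y _ _)

  Critical : Fin m → Set
  Critical a = ∃ λ z → deg H₂ z ≡ d × l ↑ʳ z ≡ f a

  Critical? : ∀ a → Dec (Critical a)
  Critical? a = any? (λ z → (deg H₂ z ≟ℕ d) ×-dec (l ↑ʳ z ≟ f a))

  Critical-unique : ∀ {a b} → Critical a → Critical b → a ≡ b
  Critical-unique (z , deg-z , z≡fa) (z′ , deg-z′ , z′≡fb) with deg-d-unique z z′ deg-z deg-z′
  ... | refl = f-injective (trans (sym z≡fa) z′≡fb)

  root : Fin m
  root with any? Critical?
  ... | yes (a , _) = a
  ... | no _ = proj₁ (count-witness c (subst (1 ≤_) (sym ∣A∣≡1+l) (s≤s z≤n)))

  Critical⇒root : ∀ {a} → Critical a → a ≡ root
  Critical⇒root {a} crit-a with any? Critical?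
  ... | yes (b , crit-b) = Critical-unique crit-a crit-b
  ... | no none = ⊥-elim (none (a , crit-a))

  open Paths T root
  open Rooted connected acyclic

  child : ∀ a → A′ a ≡ true → ∃ λ y → X∩B y ≡ true × parent y ≡ a
  child a A′a = by-criticality (Critical? a)
    where
    a∈A : c a ≡ true
    a∈A = ∧-conicalˡ _ _ A′a
    S Z : ℕ
    S = count (λ x → adj T a x ∧ X x)
    Z = count (λ x → adj T a x ∧ not (X x))
    d<S+Z : suc d ≤ S + Z
    d<S+Z = subst (suc d ≤_) (count-split (adj T a) X) (deg-A>d a a∈A)
    Z≤deg : Z ≤ deg H₂ (image a (∧-conicalʳ _ _ A′a))
    Z≤deg = outside-neighbours≤deg a _
    in-X∩B : ∀ {y} → (adj T a y ∧ X y) ≡ true → X∩B y ≡ true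
    in-X∩B ay∧Xy = cong₂ _∧_ (∧-conicalʳ _ _ ay∧Xy)
      (cong not (colour-flips T proper (∧-conicalˡ _ _ ay∧Xy) a∈A))
    by-criticality : Dec (Critical a) → ∃ λ y → X∩B y ≡ true × parent y ≡ a
    by-criticality (yes crit)
      with count-witness (λ x → adj T a x ∧ X x)
             (+-cancelʳ-≤ Z 1 S (≤-trans (s≤s (≤-trans Z≤deg (Δ≤d _))) d<S+Z))
    ... | y , ay∧Xy with edge-parent (∧-conicalˡ _ _ ay∧Xy)
    ...   | inj₁ (a≢root , _) = ⊥-elim (a≢root (Critical⇒root crit))
    ...   | inj₂ parent-y≡a = y , in-X∩B ay∧Xy , parent-y≡a
    by-criticality (no ¬crit)
      with count-two-witnesses (λ x → adj T a x ∧ X x)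
             (+-cancelʳ-≤ Z 2 S (≤-trans (s≤s Z<d) d<S+Z))
      where
      Z<d : suc Z ≤ d
      Z<d = ≤-trans (s≤s Z≤deg) (≤∧≢⇒< (Δ≤d _) (λ deg≡d → ¬crit (_ , deg≡d , image-spec a _)))
    ... | y , y′ , ay∧Xy , ay′∧Xy′ , y≢y′ with edge-parent (∧-conicalˡ _ _ ay∧Xy)
    ...   | inj₂ parent-y≡a = y , in-X∩B ay∧Xy , parent-y≡a
    ...   | inj₁ (_ , parent-a≡y) with edge-parent (∧-conicalˡ _ _ ay′∧Xy′)
    ...     | inj₂ parent-y′≡a = y′ , in-X∩B ay′∧Xy′ , parent-y′≡a
    ...     | inj₁ (_ , parent-a≡y′) = ⊥-elim (y≢y′ (trans (sym parent-a≡y) parent-a≡y′))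

  ∣A′∣≤∣X∩B∣ : count A′ ≤ count X∩B
  ∣A′∣≤∣X∩B∣ = count-injection A′ _ (λ a A′a → proj₁ (child a A′a))
    (λ a A′a → proj₁ (proj₂ (child a A′a)))
    (λ a b A′a A′b eq → trans (sym (proj₂ (proj₂ (child a A′a))))
                          (trans (cong parent eq) (proj₂ (proj₂ (child b A′b)))))

  absurd : ⊥
  absurd = 1+n≰n (begin-strict
    l                          <⟨ n<1+n l ⟩
    suc l                      ≡⟨ ∣A∣≡1+l ⟨
    count c                    ≡⟨ count-split c X ⟩
    count A∩X + count A′       ≡⟨ cong (_+ count A′) (count-cong (λ x → ∧-comm (c x) (X x))) ⟩
    count X∩A + count A′       ≤⟨ +-monoʳ-≤ (count X∩A) ∣A′∣≤∣X∩B∣ ⟩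
    count X∩A + count X∩B      ≡⟨ count-split X c ⟨
    count X                    ≤⟨ ∣X∣≤l ⟩
    l                          ∎)
    where open ≤-Reasoning

theorem1p2 : (m l δ n : ℕ) (T : Graph m) → IsTree T → InClass T l δ → m ≤ n →
    (H₁ : Graph l) (H₂ : Graph (n ∸ l)) →
    (MaxDegGe H₂ δ → EmbedsIn T (H₁ ∨G H₂)) ×
    (MaxDegLe H₂ (δ ∸ 1) →
      (∀ u v → deg H₂ u ≡ δ ∸ 1 → deg H₂ v ≡ δ ∸ 1 → u ≡ v) →
      ¬ EmbedsIn T (H₁ ∨G H₂))
theorem1p2 m l δ n T (connected , acyclic)
  class@(c , proper , ∣A∣≡1+l , _ , (v , v∈A , deg-v≡δ) , δ≤deg-A) m≤n H₁ H₂ = embeds , does-not-embed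
  where
  l≤n : l ≤ n
  l≤n = ≤-trans (n≤1+n l) (≤-trans (InClass⇒l<m T class) m≤n)
  m≤l+[n∸l] : m ≤ l + (n ∸ l)
  m≤l+[n∸l] = subst (m ≤_) (sym (m+[n∸m]≡n l≤n)) m≤n
  embeds : MaxDegGe H₂ δ → EmbedsIn T (H₁ ∨G H₂)
  embeds (w , δ≤deg-w) = Embedding.embedding T H₁ H₂ c proper ∣A∣≡1+l v v∈A w
    (subst (_≤ deg H₂ w) (sym deg-v≡δ) δ≤deg-w) m≤l+[n∸l]
  1+[δ∸1]≡δ : suc (δ ∸ 1) ≡ δ
  1+[δ∸1]≡δ = m+[n∸m]≡n (InClass⇒1≤δ T connected class)
  does-not-embed : MaxDegLe H₂ (δ ∸ 1) → (∀ u v → deg H₂ u ≡ δ ∸ 1 → deg H₂ v ≡ δ ∸ 1 → u ≡ v) →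
    ¬ EmbedsIn T (H₁ ∨G H₂)
  does-not-embed Δ≤δ∸1 deg-δ∸1-unique (f , f-injective , f-edge) =
    NoEmbedding.absurd T H₁ H₂ c proper ∣A∣≡1+l
      (λ a a∈A → subst (_≤ deg T a) (sym 1+[δ∸1]≡δ) (δ≤deg-A a a∈A))
      connected acyclic Δ≤δ∸1 deg-δ∸1-unique f f-injective f-edge
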